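{- Let $d_1<d_2<\cdots$ be positive integers such that $d_{i+1}>2^i\,\mathrm{lcm}(d_1,\dots,d_i)$ for every $i\ge1$. Let $j\ge1$ and let $r_1,\dots,r_j$ be integers such that the system $x\equiv r_i\pmod{d_i}$, $i=1,\dots,j$, has an integer solution. Then there are at least $2^j$ distinct values $r_{j+1}\in\{0,1,\dots,d_{j+1}-1\}$ for which the system $x\equiv r_i\pmod{d_i}$, $i=1,\dots,j+1$, has an integer solution. -}

module Defs where

open import Data.Nat using (ℕ; zero; suc; _≤_)
open import Data.Nat.LCM using (lcm)
open import Data.Integer using (ℤ; _-_; +_)
open import Data.Integer.Divisibility using (_∣_)
open import Data.Product using (∃)

-- lcmUpTo d i = lcm(d 1, ..., d i)   (sequence indexed from 1; d 0 unused)
-- lcm of the empty family is 1.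
lcmUpTo : (ℕ → ℕ) → ℕ → ℕ
lcmUpTo d zero    = 1
lcmUpTo d (suc i) = lcm (lcmUpTo d i) (d (suc i))

Solvable : (d : ℕ → ℕ) (r : ℕ → ℤ) (k : ℕ) → Set
Solvable d r k = ∃ λ (x : ℤ) → ∀ i → 1 ≤ i → i ≤ k → (+ d i) ∣ (x - r i)

-- If x solves the first j congruences, so does every y ≡ x (mod L), where
-- L = lcm(d₁,…,d_j).  The 2^j solutions y_t = (x mod L) + t·L, t < 2^j, have
-- pairwise differences that are nonzero multiples of L of size below
-- 2^j·L < d_{j+1}, so their residues modulo d_{j+1} are distinct; each
-- residue is an admissible r_{j+1}.
module Submission where

open import Defs
open import Data.Nat using (ℕ; suc; _≤_; _<_; _*_; _^_)
open import Data.Integer using (ℤ; +_; _-_)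
open import Data.Integer.Divisibility using (_∣_)
open import Data.Fin using (Fin)
open import Data.Product using (Σ; _×_; ∃)
open import Function.Definitions using (Injective)
open import Relation.Binary.PropositionalEquality using (_≡_)

open import Data.Nat using (zero; _+_; _∸_; NonZero; >-nonZero; s≤s; z≤n)
open import Data.Nat.Properties
open import Data.Nat.DivMod using (_%_; _/_; m≡m%n+[m/n]*n; m%n≤m; m%n<n)
open import Data.Nat.Divisibility as ℕ using (∣m+n∣m⇒∣n; ∣⇒≤; n∣m*n; ∣-trans)
open import Data.Nat.GCD using (gcd)
open import Data.Nat.LCM using (lcm; gcd*lcm; m∣lcm[m,n]; n∣lcm[m,n])
import Data.Integer as ℤ
open import Data.Integer.Properties using (pos-+; pos-*; m-n≡m⊖n; ⊖-≥)
open import Data.Integer.DivMod using (_%ℕ_; _/ℕ_; a≡a%ℕn+[a/ℕn]*n)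
open import Data.Integer.Divisibility.Signed as Signed using (∣ᵤ⇒∣; ∣⇒∣ᵤ)
open import Data.Integer.Tactic.RingSolver using (solve-∀)
open import Data.Fin using (toℕ)
open import Data.Fin.Properties using (toℕ<n; toℕ-injective)
open import Data.Product using (_,_)
open import Data.Sum using (inj₁; inj₂)
open import Relation.Binary.PropositionalEquality
  using (refl; sym; trans; cong; subst; module ≡-Reasoning)
open import Relation.Nullary using (contradiction)

lcm-nonZero : ∀ m n .{{_ : NonZero m}} .{{_ : NonZero n}} → NonZero (lcm m n)
lcm-nonZero m n = m*n≢0⇒n≢0 (gcd m n) {{subst NonZero (sym (gcd*lcm m n)) (m*n≢0 m n)}}

lcmUpTo-nonZero : ∀ d → (∀ i → 1 ≤ i → 1 ≤ d i) → ∀ j → NonZero (lcmUpTo d j)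
lcmUpTo-nonZero d d-pos zero    = _
lcmUpTo-nonZero d d-pos (suc j) =
  lcm-nonZero (lcmUpTo d j) (d (suc j))
    {{lcmUpTo-nonZero d d-pos j}} {{>-nonZero (d-pos (suc j) (s≤s z≤n))}}

∣lcmUpTo : ∀ d {i} j → 1 ≤ i → i ≤ j → d i ℕ.∣ lcmUpTo d j
∣lcmUpTo d zero    1≤i i≤0 = contradiction i≤0 (<⇒≱ 1≤i)
∣lcmUpTo d (suc j) 1≤i i≤1+j with m≤n⇒m<n∨m≡n i≤1+j
... | inj₁ (s≤s i≤j) = ∣-trans (∣lcmUpTo d j 1≤i i≤j) (m∣lcm[m,n] (lcmUpTo d j) _)
... | inj₂ refl      = n∣lcm[m,n] (lcmUpTo d j) _

n∣m∸m%n : ∀ m n .{{_ : NonZero n}} → n ℕ.∣ m ∸ m % n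
n∣m∸m%n m n = subst (n ℕ.∣_) (sym m∸m%n≡m/n*n) (n∣m*n (m / n))
  where
  m∸m%n≡m/n*n : m ∸ m % n ≡ m / n * n
  m∸m%n≡m/n*n = trans (cong (_∸ m % n) (m≡m%n+[m/n]*n m n)) (m+n∸m≡n (m % n) _)

[m+k]%n≡m%n⇒k≡0 : ∀ m {k n} .{{_ : NonZero n}} → k < n → (m + k) % n ≡ m % n → k ≡ 0
[m+k]%n≡m%n⇒k≡0 m {zero}  k<n eq = refl
[m+k]%n≡m%n⇒k≡0 m {suc k} {n} k<n eq = contradiction (∣⇒≤ n∣1+k) (<⇒≱ k<n)
  where
  open ≡-Reasoning
  m∸m%n+1+k≡[m+1+k]∸[m+1+k]%n : (m ∸ m % n) + suc k ≡ (m + suc k) ∸ (m + suc k) % n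
  m∸m%n+1+k≡[m+1+k]∸[m+1+k]%n = begin
    (m ∸ m % n) + suc k       ≡⟨ +-∸-comm (suc k) (m%n≤m m n) ⟨
    (m + suc k) ∸ m % n       ≡⟨ cong ((m + suc k) ∸_) eq ⟨
    (m + suc k) ∸ (m + suc k) % n ∎
  n∣1+k : n ℕ.∣ suc k
  n∣1+k = ∣m+n∣m⇒∣n
    (subst (n ℕ.∣_) (sym m∸m%n+1+k≡[m+1+k]∸[m+1+k]%n) (n∣m∸m%n (m + suc k) n))
    (n∣m∸m%n m n)

%-injective-on-progression-≤ : ∀ x L {a b n} .{{_ : NonZero L}} .{{_ : NonZero n}} →
  a ≤ b → b * L < n → (x + b * L) % n ≡ (x + a * L) % n → b ≡ a
%-injective-on-progression-≤ x L {a} {b} {n} a≤b bL<n eq =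
  ≤-antisym (m∸n≡0⇒m≤n (m*n≡0⇒m≡0 (b ∸ a) L [b∸a]*L≡0)) a≤b
  where
  open ≡-Reasoning
  x+b*L≡x+a*L+[b∸a]*L : x + b * L ≡ (x + a * L) + (b ∸ a) * L
  x+b*L≡x+a*L+[b∸a]*L = begin
    x + b * L                   ≡⟨ cong (λ c → x + c * L) (m+[n∸m]≡n a≤b) ⟨
    x + (a + (b ∸ a)) * L       ≡⟨ cong (λ c → x + c) (*-distribʳ-+ L a (b ∸ a)) ⟩
    x + (a * L + (b ∸ a) * L)   ≡⟨ +-assoc x _ _ ⟨
    (x + a * L) + (b ∸ a) * L   ∎
  [b∸a]*L≡0 : (b ∸ a) * L ≡ 0
  [b∸a]*L≡0 = [m+k]%n≡m%n⇒k≡0 (x + a * L)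
    (≤-<-trans (*-monoˡ-≤ L (m∸n≤m b a)) bL<n)
    (trans (cong (_% n) (sym x+b*L≡x+a*L+[b∸a]*L)) eq)

%-injective-on-progression : ∀ x L {a b n} .{{_ : NonZero L}} .{{_ : NonZero n}} →
  a * L < n → b * L < n → (x + a * L) % n ≡ (x + b * L) % n → a ≡ b
%-injective-on-progression x L {a} {b} aL<n bL<n eq with ≤-total a b
... | inj₁ a≤b = sym (%-injective-on-progression-≤ x L a≤b bL<n (sym eq))
... | inj₂ b≤a = %-injective-on-progression-≤ x L b≤a aL<n eq

Solves : (ℕ → ℕ) → (ℕ → ℤ) → ℕ → ℤ → Set
Solves d r j x = ∀ i → 1 ≤ i → i ≤ j → (+ d i) ∣ (x - r i)

[x+y]-r≡[x-r]+y : ∀ x y r → (x ℤ.+ y) - r ≡ (x - r) ℤ.+ y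
[x+y]-r≡[x-r]+y = solve-∀

Solves-+-multiple-of-lcmUpTo : ∀ {d r j x} → Solves d r j x →
  ∀ k → Solves d r j (x ℤ.+ k ℤ.* + lcmUpTo d j)
Solves-+-multiple-of-lcmUpTo {d} {r} {j} {x} x-solves k i 1≤i i≤j =
  ∣⇒∣ᵤ (subst (+ d i Signed.∣_) (sym ([x+y]-r≡[x-r]+y x _ (r i)))
    (Signed.∣m∣n⇒∣m+n (∣ᵤ⇒∣ {i = x - r i} (x-solves i 1≤i i≤j))
                      (Signed.∣n⇒∣m*n k (∣ᵤ⇒∣ {i = + lcmUpTo d j} (∣lcmUpTo d j 1≤i i≤j)))))

a+t*n≡[a+q*n]+[t-q]*n : ∀ a t q n → a ℤ.+ t ℤ.* n ≡ (a ℤ.+ q ℤ.* n) ℤ.+ (t - q) ℤ.* n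
a+t*n≡[a+q*n]+[t-q]*n = solve-∀

x%ℕn+t*n≡x+[t-x/ℕn]*n : ∀ x t n .{{_ : NonZero n}} →
  + (x %ℕ n + t * n) ≡ x ℤ.+ (+ t - x /ℕ n) ℤ.* + n
x%ℕn+t*n≡x+[t-x/ℕn]*n x t n = begin
  + (x %ℕ n + t * n)                           ≡⟨ pos-+ (x %ℕ n) (t * n) ⟩
  + (x %ℕ n) ℤ.+ + (t * n)                     ≡⟨ cong (λ y → + (x %ℕ n) ℤ.+ y) (pos-* t n) ⟩
  + (x %ℕ n) ℤ.+ + t ℤ.* + n                   ≡⟨ a+t*n≡[a+q*n]+[t-q]*n (+ (x %ℕ n)) (+ t) (x /ℕ n) (+ n) ⟩
  (+ (x %ℕ n) ℤ.+ x /ℕ n ℤ.* + n) ℤ.+ (+ t - x /ℕ n) ℤ.* + n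
    ≡⟨ cong (ℤ._+ (+ t - x /ℕ n) ℤ.* + n) (a≡a%ℕn+[a/ℕn]*n x n) ⟨
  x ℤ.+ (+ t - x /ℕ n) ℤ.* + n                 ∎
  where open ≡-Reasoning

n∣m-m%n : ∀ m n .{{_ : NonZero n}} → (+ n) ∣ (+ m - + (m % n))
n∣m-m%n m n = subst (λ z → n ℕ.∣ ℤ.∣ z ∣) (sym +m-+[m%n]≡+[m∸m%n]) (n∣m∸m%n m n)
  where
  +m-+[m%n]≡+[m∸m%n] : + m - + (m % n) ≡ + (m ∸ m % n)
  +m-+[m%n]≡+[m∸m%n] = trans (m-n≡m⊖n m (m % n)) (⊖-≥ (m%n≤m m n))

lemma6 : (d : ℕ → ℕ) → (∀ i → 1 ≤ i → 1 ≤ d i) → (∀ i → 1 ≤ i → d i < d (suc i))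
         → (∀ i → 1 ≤ i → 2 ^ i * lcmUpTo d i < d (suc i))
         → (j : ℕ) → 1 ≤ j → (r : ℕ → ℤ) → Solvable d r j
         → Σ (Fin (2 ^ j) → ℕ) λ v → Injective _≡_ _≡_ v
             × (∀ k → v k < d (suc j))
             × (∀ k → ∃ λ (x : ℤ) → (∀ i → 1 ≤ i → i ≤ j → (+ d i) ∣ (x - r i))
                  × (+ d (suc j)) ∣ (x - + v k))
lemma6 d d-pos _ d-large j 1≤j r (x , x-solves) = v , v-injective , v<D , v-admissible
  where
  L = lcmUpTo d j
  D = d (suc j)
  instance
    _ : NonZero L
    _ = lcmUpTo-nonZero d d-pos j
    _ : NonZero D
    _ = >-nonZero (d-pos (suc j) (s≤s z≤n))

  y : Fin (2 ^ j) → ℕ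
  y t = x %ℕ L + toℕ t * L

  v : Fin (2 ^ j) → ℕ
  v t = y t % D

  t*L<D : ∀ t → toℕ t * L < D
  t*L<D t = ≤-<-trans (*-monoˡ-≤ L (<⇒≤ (toℕ<n t))) (d-large j 1≤j)

  v-injective : Injective _≡_ _≡_ v
  v-injective {s} {t} eq =
    toℕ-injective (%-injective-on-progression (x %ℕ L) L (t*L<D s) (t*L<D t) eq)

  v<D : ∀ t → v t < D
  v<D t = m%n<n (y t) D

  v-admissible : ∀ t → ∃ λ (z : ℤ) → Solves d r j z × (+ D) ∣ (z - + v t)
  v-admissible t = + y t
    , subst (Solves d r j) (sym (x%ℕn+t*n≡x+[t-x/ℕn]*n x (toℕ t) L))
        (Solves-+-multiple-of-lcmUpTo {r = r} {x = x} x-solves (+ toℕ t - x /ℕ L))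
    , n∣m-m%n (y t) D
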